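{- Let $q\in\mathbb{C}$, $s\in\mathbb{N}_0$, $\alpha_0,\dots,\alpha_s\in\mathbb{C}$, $n\ge1$, and let $\lambda_{n-1}\ge\lambda_{n-2}\ge\cdots\ge\lambda_0\ge0$ be integers. Let $\mathbf{k}=(k_0,\dots,k_s)\in\mathbb{N}_0^{s+1}$. Then $$m_{\mathbf{k}}(B_n(\lambda);q)=q^{\lambda_{n-1}+\sum_{j=0}^s(j-1)k_j}\,m_{\mathbf{k}}(B_{n-1}(\lambda);q)+\sum_{r=0}^s\alpha_r\Big[\lambda_{n-1}+\sum_{j=0}^s(j-1)k_j-(r-1)\Big]_q m_{\mathbf{k}^{(r)}}(B_{n-1}(\lambda);q),$$ where $\mathbf{k}^{(r)}=(k_0-\delta_{r,0},\dots,k_s-\delta_{r,s})$ and only summands with $\mathbf{k}^{(r)}\in\mathbb{N}_0^{s+1}$ contribute. Moreover $m_{\mathbf{0}}(B_n(\lambda);q)=q^{|\lambda|}$ with $|\lambda|=\lambda_{n-1}+\cdots+\lambda_0$.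
   Context: $B_n(\lambda)$ is the Ferrers board (top-aligned columns) with $n$ columns whose heights, from left to right, are $\lambda_{n-1},\lambda_{n-2},\dots,\lambda_0$; $B_{n-1}(\lambda)$ is the board with columns of heights $\lambda_{n-2},\dots,\lambda_0$ (i.e. $B_n(\lambda)$ with its leftmost column removed). $[m]_q=1+q+\cdots+q^{m-1}$ for $m\ge1$, $[m]_q=0$ for $m\le0$. $\boldsymbol{\alpha}^{\mathbf{k}}=\prod_j\alpha_j^{k_j}$. Mixed rook placements (Goldman–Haglund row creation rule): let $B$ have columns $c_1,\dots,c_N$ from left to right with heights $h_1\ge\cdots\ge h_N\ge0$. A mixed rook placement of type $\mathbf{k}$ is built by processing columns from right to left; in each column one places either no rook or one rook of some weight $w\in\{0,\dots,s\}$; a rook of weight $w$ occupies its row (unavailable in all columns to its left) and creates $w$ new rows extending all columns to its left. Concretely column $c$ has $a_c=h_c+\sum(w-1)$ available cells, the sum over rooks already placed in columns to its right ($a_c\ge0$ always); available cells are ordered bottom (position 1) to top (position $a_c$), and a rook in column $c$ sits at a position $p_c\in\{1,\dots,a_c\}$. There are exactly $k_w$ rooks of weight $w$. $\mathcal{M}_{\mathbf{k}}(B)$ is the set of such placements. Empty boxes: all $a_c$ available cells of a column without a rook, and the $p_c-1$ available cells below the rook in a column with a rook. $m_{\mathbf{k}}(B;q)=\boldsymbol{\alpha}^{\mathbf{k}}\sum_{\phi\in\mathcal{M}_{\mathbf{k}}(B)}q^{\#\text{empty boxes of }\phi}$ (zero if $\mathcal{M}_{\mathbf{k}}(B)$ is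 empty). -}

module Defs where

open import Level using (Level)
open import Algebra.Bundles using (CommutativeRing)
open import Data.Nat as ℕ using (ℕ; zero; suc)
open import Data.Integer as ℤ using (ℤ; +_; -[1+_])
open import Data.Fin as Fin using (Fin; toℕ)
open import Data.List as List using (List; []; _∷_; _++_; map; concatMap; allFin)
open import Data.Vec as Vec using (Vec; lookup)
open import Data.Vec.Properties using (≡-dec)
open import Relation.Nullary using (yes; no)

-- A column choice in a mixed rook placement with weights in {0,..,s}:
-- no rook, or a rook of weight w at position p (positions 1..a_c, bottom = 1).
data Choice (s : ℕ) : Set where
  none : Choice s
  rook : Fin (suc s) → ℕ → Choice s

-- Boards are given as lists of column heights from RIGHT to LEFT
-- (the order in which columns are processed).

-- number of available cells: a_c if a_c ≥ 0 (always the case), else 0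
avail : ℤ → ℕ
avail (+ n) = n
avail -[1+ n ] = 0

shift : {s : ℕ} → Fin (suc s) → ℤ
shift w = (+ toℕ w) ℤ.- (+ 1)

-- All mixed rook placements (any type) of a board, columns processed right to
-- left; d is the current offset Σ (w-1) over rooks already placed to the right,
-- so that the current column of height h has a_c = h + d available cells.
placements : (s : ℕ) → ℤ → List ℕ → List (List (Choice s))
placements s d [] = [] ∷ []
placements s d (h ∷ hs) =
  map (none ∷_) (placements s d hs)
  ++ concatMap (λ w → concatMap (λ p → map (rook w (suc p) ∷_)
                                          (placements s (d ℤ.+ shift w) hs))
                                (List.upTo (avail ((+ h) ℤ.+ d))))
               (allFin (suc s))

typeOf : {s : ℕ} → List (Choice s) → Vec ℕ (suc s)
typeOf [] = Vec.replicate _ 0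
typeOf (none ∷ φ) = typeOf φ
typeOf (rook w p ∷ φ) = Vec.updateAt (typeOf φ) w suc

emptyBoxes : {s : ℕ} → ℤ → List ℕ → List (Choice s) → ℕ
emptyBoxes d (h ∷ hs) (none ∷ φ) = avail ((+ h) ℤ.+ d) ℕ.+ emptyBoxes d hs φ
emptyBoxes d (h ∷ hs) (rook w p ∷ φ) = (p ℕ.∸ 1) ℕ.+ emptyBoxes (d ℤ.+ shift w) hs φ
emptyBoxes d _ _ = 0

-- B_n(λ), λ : Fin n → ℕ with λ i = λ_i, as right-to-left list λ_0, ..., λ_{n-1}
board : (n : ℕ) → (Fin n → ℕ) → List ℕ
board n lam = map lam (allFin n)

size : (n : ℕ) → (Fin n → ℕ) → ℕ
size n lam = List.foldr ℕ._+_ 0 (board n lam)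

offsetOf : {s : ℕ} → Vec ℕ (suc s) → ℤ
offsetOf {s} k = List.foldr ℤ._+_ (+ 0)
  (map (λ j → shift j ℤ.* (+ lookup k j)) (allFin (suc s)))

module _ {c ℓ : Level} (R : CommutativeRing c ℓ) where
  open CommutativeRing R

  pow : Carrier → ℕ → Carrier
  pow x zero = 1#
  pow x (suc n) = x * pow x n

  sumL : List Carrier → Carrier
  sumL = List.foldr _+_ 0#

  -- q^e for integer e; for e < 0 we return 0 (such terms only occur multiplied
  -- by m_k(B_{n-1}) = 0)
  powℤ : Carrier → ℤ → Carrier
  powℤ q (+ n) = pow q n
  powℤ q -[1+ n ] = 0#

  qint : Carrier → ℤ → Carrier
  qint q (+ m) = sumL (map (pow q) (List.upTo m))
  qint q -[1+ m ] = 0#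

  αpow : {s : ℕ} → (Fin (suc s) → Carrier) → Vec ℕ (suc s) → Carrier
  αpow {s} α k = List.foldr _*_ 1# (map (λ j → pow (α j) (lookup k j)) (allFin (suc s)))

  mk : (s : ℕ) → (Fin (suc s) → Carrier) → Carrier → Vec ℕ (suc s) → List ℕ → Carrier
  mk s α q k B = αpow α k * sumL (map term (placements s (+ 0) B))
    where
    term : List (Choice s) → Carrier
    term φ with ≡-dec ℕ._≟_ (typeOf φ) k
    ... | yes _ = pow q (emptyBoxes (+ 0) B φ)
    ... | no _ = 0#

  mkOrZero : (s : ℕ) → (Fin (suc s) → Carrier) → Carrier → Vec ℕ (suc s)
           → Fin (suc s) → List ℕ → Carrier
  mkOrZero s α q k r B with lookup k r
  ... | zero = 0#
  ... | suc kr = mk s α q (Vec.updateAt k r (λ _ → kr)) B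

-- Split off the leftmost column of B_n(λ), the last one the row creation rule processes.
-- A placement of B_n(λ) is a placement φ of B_{n-1}(λ) followed by a choice in that column,
-- which then has λ_{n-1} + Σ_j (j-1) t_j available cells, t being the type of φ. Leaving the
-- column empty multiplies the weight of φ by q to that power (and needs t = k); a rook of
-- weight r at height p multiplies it by α_r q^{p-1} (and needs t = k^(r)), and summing over p
-- gives α_r [λ_{n-1} + Σ_j (j-1) k_j - (r-1)]_q. As the heights weakly increase to the left,
-- the number of available cells is never negative. For k = 0 only the placement without
-- rooks has the right type, and all its cells are empty.

module Submission where

open import Defs
open import Level using (Level)
open import Algebra.Bundles using (CommutativeRing)
open import Data.Nat using (ℕ; suc; _≤_)
open import Data.Integer as ℤ using (ℤ; +_)
open import Data.Fin as Fin using (Fin; toℕ; inject₁; fromℕ)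
open import Data.List using (map; allFin; foldr)
open import Data.Vec using (Vec; lookup; updateAt; replicate)
open import Data.Nat using (_∸_)
open import Data.Product using (_×_)

open import Algebra.Bundles using (CommutativeMonoid)
import Data.Vec as Vec
open import Data.Product using (_,_)
open import Data.Nat using (zero; _<_; z≤n; s≤s)
import Data.Nat as ℕ
import Data.Nat.Properties as ℕₚ
import Data.Integer.Properties as ℤₚ
open import Data.Integer.Tactic.RingSolver using (solve-∀)
open import Data.List using (List; []; _∷_; _++_; [_]; length; tabulate; upTo; concatMap)
open import Data.List.Properties using (map-cong; map-tabulate)
open import Data.List.Relation.Unary.All as All using (All; []; _∷_)
open import Data.List.Relation.Unary.All.Properties using (++⁺; map⁺; concat⁺; tabulate⁺; applyUpTo⁺₁)
open import Data.List.Relation.Unary.Linked using (Linked; [-]; _∷_)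
open import Data.Vec.Properties using (≡-dec; lookup-replicate; updateAt-commutes; updateAt-updateAt-local; updateAt-id; lookup∘updateAt)
open import Function using (_∘_)
open import Data.Empty using (⊥-elim)
open import Relation.Nullary using (Dec; yes; no)
open import Relation.Binary.PropositionalEquality as ≡ using (_≡_; _≢_)

rowOffset : {s : ℕ} → List (Choice s) → ℤ
rowOffset [] = + 0
rowOffset (none ∷ φ) = rowOffset φ
rowOffset (rook w _ ∷ φ) = shift w ℤ.+ rowOffset φ

updateAt-suc-comm : ∀ {n} (t : Vec ℕ n) i j →
  updateAt (updateAt t i suc) j suc ≡ updateAt (updateAt t j suc) i suc
updateAt-suc-comm t i j with i Fin.≟ j
... | yes ≡.refl = ≡.refl
... | no i≢j = updateAt-commutes j i (i≢j ∘ ≡.sym) t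

updateAt-suc≢ : ∀ {n} (t k : Vec ℕ n) r → lookup k r ≡ 0 → updateAt t r suc ≢ k
updateAt-suc≢ t k r k[r]≡0 ≡.refl with ≡.trans (≡.sym (lookup∘updateAt r t)) k[r]≡0
... | ()

updateAt-suc≡⇒ : ∀ {n} (t k : Vec ℕ n) r {j} → lookup k r ≡ suc j →
  updateAt t r suc ≡ k → t ≡ updateAt k r (λ _ → j)
updateAt-suc≡⇒ t k r k[r]≡1+j ≡.refl =
  ≡.sym (≡.trans (updateAt-updateAt-local r t
                   (ℕₚ.suc-injective (≡.trans (≡.sym k[r]≡1+j) (lookup∘updateAt r t))))
                 (updateAt-id r t))

updateAt-suc≡⇐ : ∀ {n} (t k : Vec ℕ n) r {j} → lookup k r ≡ suc j →
  t ≡ updateAt k r (λ _ → j) → updateAt t r suc ≡ k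
updateAt-suc≡⇐ t k r k[r]≡1+j ≡.refl =
  ≡.trans (updateAt-updateAt-local r k (≡.sym k[r]≡1+j)) (updateAt-id r k)

typeOf-++-none : ∀ {s} (φ : List (Choice s)) → typeOf (φ ++ [ none ]) ≡ typeOf φ
typeOf-++-none [] = ≡.refl
typeOf-++-none (none ∷ φ) = typeOf-++-none φ
typeOf-++-none (rook w _ ∷ φ) = ≡.cong (λ t → updateAt t w suc) (typeOf-++-none φ)

typeOf-++-rook : ∀ {s} (φ : List (Choice s)) w p →
  typeOf (φ ++ [ rook w p ]) ≡ updateAt (typeOf φ) w suc
typeOf-++-rook [] w p = ≡.refl
typeOf-++-rook (none ∷ φ) w p = typeOf-++-rook φ w p
typeOf-++-rook (rook w′ _ ∷ φ) w p =
  ≡.trans (≡.cong (λ t → updateAt t w′ suc) (typeOf-++-rook φ w p))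
          (updateAt-suc-comm (typeOf φ) w w′)

emptyBoxes-++ : ∀ {s} d hs ks (φ χ : List (Choice s)) → length φ ≡ length hs →
  emptyBoxes d (hs ++ ks) (φ ++ χ) ≡ emptyBoxes d hs φ ℕ.+ emptyBoxes (d ℤ.+ rowOffset φ) ks χ
emptyBoxes-++ d [] ks [] χ _ = ≡.cong (λ d′ → emptyBoxes d′ ks χ) (≡.sym (ℤₚ.+-identityʳ d))
emptyBoxes-++ d (h ∷ hs) ks (none ∷ φ) χ eq =
  ≡.trans (≡.cong (avail (+ h ℤ.+ d) ℕ.+_) (emptyBoxes-++ d hs ks φ χ (ℕₚ.suc-injective eq)))
          (≡.sym (ℕₚ.+-assoc (avail (+ h ℤ.+ d)) _ _))
emptyBoxes-++ d (h ∷ hs) ks (rook w p ∷ φ) χ eq =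
  ≡.trans (≡.cong ((p ∸ 1) ℕ.+_) (emptyBoxes-++ (d ℤ.+ shift w) hs ks φ χ (ℕₚ.suc-injective eq)))
   (≡.trans (≡.cong (λ d′ → (p ∸ 1) ℕ.+ (emptyBoxes (d ℤ.+ shift w) hs φ ℕ.+ emptyBoxes d′ ks χ))
                    (ℤₚ.+-assoc d (shift w) (rowOffset φ)))
            (≡.sym (ℕₚ.+-assoc (p ∸ 1) _ _)))

All-placements-∷ : ∀ {s} {P : List (Choice s) → Set} d h hs →
  All (P ∘ (none ∷_)) (placements s d hs) →
  (∀ w {p} → p < avail (+ h ℤ.+ d) → All (P ∘ (rook w (suc p) ∷_)) (placements s (d ℤ.+ shift w) hs)) →
  All P (placements s d (h ∷ hs))
All-placements-∷ d h hs none-ok rook-ok =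
  ++⁺ (map⁺ none-ok)
      (concat⁺ (map⁺ (tabulate⁺ λ w →
        concat⁺ (map⁺ (applyUpTo⁺₁ _ (avail (+ h ℤ.+ d)) λ p< → map⁺ (rook-ok w p<))))))

placements-length : ∀ s d hs → All (λ φ → length φ ≡ length hs) (placements s d hs)
placements-length s d [] = ≡.refl ∷ []
placements-length s d (h ∷ hs) =
  All-placements-∷ d h hs (All.map (≡.cong suc) (placements-length s d hs))
                          (λ w _ → All.map (≡.cong suc) (placements-length s (d ℤ.+ shift w) hs))

nonneg-mono : ∀ {x y} d → x ≤ y → ℤ.0ℤ ℤ.≤ + x ℤ.+ d → ℤ.0ℤ ℤ.≤ + y ℤ.+ d
nonneg-mono d x≤y 0≤x+d = ℤₚ.≤-trans 0≤x+d (ℤₚ.+-monoˡ-≤ d (ℤ.+≤+ x≤y))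

1+a+[t-1]≡a+t : ∀ a t → (+ 1 ℤ.+ a) ℤ.+ (t ℤ.- + 1) ≡ a ℤ.+ t
1+a+[t-1]≡a+t = solve-∀

a+[b+c]-b≡a+c : ∀ a b c → a ℤ.+ (b ℤ.+ c) ℤ.- b ≡ a ℤ.+ c
a+[b+c]-b≡a+c = solve-∀

nonneg-+-shift : ∀ {s} z {p} (w : Fin (suc s)) → p < avail z → ℤ.0ℤ ℤ.≤ z ℤ.+ shift w
nonneg-+-shift (+ suc a) w _ rewrite 1+a+[t-1]≡a+t (+ a) (+ toℕ w) = ℤ.+≤+ z≤n

-- A rook at height p ≤ a_c leaves a_c - p + w ≥ 0 cells to the next column, which is at
-- least as tall; so the junk value 0 of powℤ at negative exponents is never reached.
placements-avail-nonneg : ∀ s d {x} hs h → ℤ.0ℤ ℤ.≤ + x ℤ.+ d → Linked _≤_ (x ∷ hs ++ [ h ]) →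
  All (λ φ → ℤ.0ℤ ℤ.≤ + h ℤ.+ (d ℤ.+ rowOffset φ)) (placements s d hs)
placements-avail-nonneg s d [] h 0≤x+d (x≤h ∷ [-]) =
  ≡.subst (λ d′ → ℤ.0ℤ ℤ.≤ + h ℤ.+ d′) (≡.sym (ℤₚ.+-identityʳ d)) (nonneg-mono d x≤h 0≤x+d) ∷ []
placements-avail-nonneg s d (y ∷ hs) h 0≤x+d (x≤y ∷ sorted) =
  All-placements-∷ d y hs (placements-avail-nonneg s d hs h 0≤y+d sorted) λ w p< →
    All.map (≡.subst (λ d′ → ℤ.0ℤ ℤ.≤ + h ℤ.+ d′) (ℤₚ.+-assoc d (shift w) _))
      (placements-avail-nonneg s (d ℤ.+ shift w) hs h
        (≡.subst (ℤ.0ℤ ℤ.≤_) (ℤₚ.+-assoc (+ y) d (shift w)) (nonneg-+-shift (+ y ℤ.+ d) w p<))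
        sorted)
  where
  0≤y+d : ℤ.0ℤ ℤ.≤ + y ℤ.+ d
  0≤y+d = nonneg-mono d x≤y 0≤x+d

module _ {c ℓ : Level} (M : CommutativeMonoid c ℓ) where
  open CommutativeMonoid M
  open import Algebra.Properties.CommutativeSemigroup commutativeSemigroup using (x∙yz≈y∙xz)

  foldr-tabulate-updateAt-suc : ∀ {n} (g : Fin n → ℕ → Carrier) (a : Fin n → Carrier) →
    (∀ j x → g j (suc x) ≈ a j ∙ g j x) → ∀ k w →
    foldr _∙_ ε (tabulate (λ j → g j (lookup (updateAt k w suc) j)))
      ≈ a w ∙ foldr _∙_ ε (tabulate (λ j → g j (lookup k j)))
  foldr-tabulate-updateAt-suc g a g-suc (x Vec.∷ k) Fin.zero =
    trans (∙-congʳ (g-suc Fin.zero x)) (assoc _ _ _)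
  foldr-tabulate-updateAt-suc g a g-suc (x Vec.∷ k) (Fin.suc w) =
    trans (∙-congˡ (foldr-tabulate-updateAt-suc (g ∘ Fin.suc) (a ∘ Fin.suc) (g-suc ∘ Fin.suc) k w))
          (x∙yz≈y∙xz _ _ _)

  foldr-tabulate-replicate-0 : ∀ n (g : Fin n → ℕ → Carrier) → (∀ j → g j 0 ≈ ε) →
    foldr _∙_ ε (tabulate (λ j → g j (lookup (replicate n 0) j))) ≈ ε
  foldr-tabulate-replicate-0 zero g g-0 = refl
  foldr-tabulate-replicate-0 (suc n) g g-0 =
    trans (∙-cong (g-0 Fin.zero) (foldr-tabulate-replicate-0 n (g ∘ Fin.suc) (g-0 ∘ Fin.suc))) (identityˡ ε)

offsetOf-tabulate : ∀ {s} (k : Vec ℕ (suc s)) →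
  offsetOf k ≡ foldr ℤ._+_ (+ 0) (tabulate (λ j → shift j ℤ.* + lookup k j))
offsetOf-tabulate k = ≡.cong (foldr ℤ._+_ (+ 0)) (map-tabulate (λ j → j) (λ j → shift j ℤ.* + lookup k j))

offsetOf-updateAt-suc : ∀ {s} (k : Vec ℕ (suc s)) w →
  offsetOf (updateAt k w suc) ≡ shift w ℤ.+ offsetOf k
offsetOf-updateAt-suc k w =
  ≡.trans (offsetOf-tabulate (updateAt k w suc))
   (≡.trans (foldr-tabulate-updateAt-suc ℤₚ.+-0-commutativeMonoid (λ j x → shift j ℤ.* + x) shift
               (λ j x → ℤₚ.*-suc (shift j) (+ x)) k w)
            (≡.cong (λ o → shift w ℤ.+ o) (≡.sym (offsetOf-tabulate k))))

offsetOf-replicate-0 : ∀ s → offsetOf (replicate (suc s) 0) ≡ + 0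
offsetOf-replicate-0 s =
  ≡.trans (offsetOf-tabulate (replicate (suc s) 0))
          (foldr-tabulate-replicate-0 ℤₚ.+-0-commutativeMonoid (suc s) (λ j x → shift j ℤ.* + x)
            (λ j → ℤₚ.*-zeroʳ (shift j)))

rowOffset≡offsetOf-typeOf : ∀ {s} (φ : List (Choice s)) → rowOffset φ ≡ offsetOf (typeOf φ)
rowOffset≡offsetOf-typeOf {s} [] = ≡.sym (offsetOf-replicate-0 s)
rowOffset≡offsetOf-typeOf (none ∷ φ) = rowOffset≡offsetOf-typeOf φ
rowOffset≡offsetOf-typeOf (rook w _ ∷ φ) =
  ≡.trans (≡.cong (λ o → shift w ℤ.+ o) (rowOffset≡offsetOf-typeOf φ))
          (≡.sym (offsetOf-updateAt-suc (typeOf φ) w))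

tabulate-++-last : ∀ {A : Set} m (f : Fin (suc m) → A) →
  tabulate f ≡ tabulate (f ∘ inject₁) ++ [ f (fromℕ m) ]
tabulate-++-last zero f = ≡.refl
tabulate-++-last (suc m) f = ≡.cong (f Fin.zero ∷_) (tabulate-++-last m (f ∘ Fin.suc))

board-++-last : ∀ m (lam : Fin (suc m) → ℕ) → board (suc m) lam ≡ board m (lam ∘ inject₁) ++ [ lam (fromℕ m) ]
board-++-last m lam =
  ≡.trans (map-tabulate (λ i → i) lam)
   (≡.trans (tabulate-++-last m lam)
            (≡.cong (_++ [ lam (fromℕ m) ]) (≡.sym (map-tabulate (λ i → i) (lam ∘ inject₁)))))

Monotone : ∀ {n} → (Fin n → ℕ) → Set
Monotone lam = ∀ i j → i Fin.≤ j → lam i ≤ lam j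

linked-tabulate : ∀ {n} x (lam : Fin n → ℕ) → (∀ i → x ≤ lam i) → Monotone lam → Linked _≤_ (x ∷ tabulate lam)
linked-tabulate {zero} x lam x≤ mono = [-]
linked-tabulate {suc n} x lam x≤ mono =
  x≤ Fin.zero ∷ linked-tabulate (lam Fin.zero) (lam ∘ Fin.suc) (λ i → mono Fin.zero (Fin.suc i) z≤n)
                                (λ i j i≤j → mono (Fin.suc i) (Fin.suc j) (s≤s i≤j))

board-sorted : ∀ {n} (lam : Fin n → ℕ) → Monotone lam → Linked _≤_ (0 ∷ board n lam)
board-sorted lam mono =
  ≡.subst (λ B → Linked _≤_ (0 ∷ B)) (≡.sym (map-tabulate (λ i → i) lam)) (linked-tabulate 0 lam (λ _ → z≤n) mono)

private variable
  A B : Set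

module _ {c ℓ : Level} (R : CommutativeRing c ℓ) where
  open CommutativeRing R
  open import Algebra.Properties.CommutativeSemigroup +-commutativeSemigroup using (interchange)

  ∑ : List A → (A → Carrier) → Carrier
  ∑ xs f = sumL R (map f xs)

  ∑-cong-All : ∀ {xs : List A} {f g : A → Carrier} → All (λ x → f x ≈ g x) xs → ∑ xs f ≈ ∑ xs g
  ∑-cong-All [] = refl
  ∑-cong-All (fx≈gx ∷ rest) = +-cong fx≈gx (∑-cong-All rest)

  ∑-cong : ∀ (xs : List A) {f g : A → Carrier} → (∀ x → f x ≈ g x) → ∑ xs f ≈ ∑ xs g
  ∑-cong xs f≈g = ∑-cong-All (All.universal f≈g xs)

  ∑-zero : ∀ (xs : List A) {f : A → Carrier} → (∀ x → f x ≈ 0#) → ∑ xs f ≈ 0#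
  ∑-zero [] f≈0 = refl
  ∑-zero (x ∷ xs) f≈0 = trans (+-cong (f≈0 x) (∑-zero xs f≈0)) (+-identityˡ 0#)

  ∑-++ : ∀ (xs ys : List A) (f : A → Carrier) → ∑ (xs ++ ys) f ≈ ∑ xs f + ∑ ys f
  ∑-++ [] ys f = sym (+-identityˡ _)
  ∑-++ (x ∷ xs) ys f = trans (+-congˡ (∑-++ xs ys f)) (sym (+-assoc _ _ _))

  ∑-+ : ∀ (xs : List A) (f g : A → Carrier) → ∑ xs (λ x → f x + g x) ≈ ∑ xs f + ∑ xs g
  ∑-+ [] f g = sym (+-identityˡ 0#)
  ∑-+ (x ∷ xs) f g = trans (+-congˡ (∑-+ xs f g)) (interchange _ _ _ _)

  ∑-*ˡ : ∀ (xs : List A) (a : Carrier) (f : A → Carrier) → ∑ xs (λ x → a * f x) ≈ a * ∑ xs f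
  ∑-*ˡ [] a f = sym (zeroʳ a)
  ∑-*ˡ (x ∷ xs) a f = trans (+-congˡ (∑-*ˡ xs a f)) (sym (distribˡ a _ _))

  ∑-map : (xs : List B) (g : B → A) (f : A → Carrier) → ∑ (map g xs) f ≈ ∑ xs (f ∘ g)
  ∑-map [] g f = refl
  ∑-map (x ∷ xs) g f = +-congˡ (∑-map xs g f)

  ∑-concatMap : (xs : List B) (g : B → List A) (f : A → Carrier) →
    ∑ (concatMap g xs) f ≈ ∑ xs (λ x → ∑ (g x) f)
  ∑-concatMap [] g f = refl
  ∑-concatMap (x ∷ xs) g f = trans (∑-++ (g x) (concatMap g xs) f) (+-congˡ (∑-concatMap xs g f))

  ∑-swap : (xs : List A) (ys : List B) (f : A → B → Carrier) →
    ∑ xs (λ x → ∑ ys (f x)) ≈ ∑ ys (λ y → ∑ xs (λ x → f x y))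
  ∑-swap [] ys f = sym (∑-zero ys (λ _ → refl))
  ∑-swap (x ∷ xs) ys f = trans (+-congˡ (∑-swap xs ys f)) (sym (∑-+ ys (f x) _))

  ∑-placements-∷ : ∀ {s} d h hs (F : List (Choice s) → Carrier) →
    ∑ (placements s d (h ∷ hs)) F
      ≈ ∑ (placements s d hs) (F ∘ (none ∷_))
        + ∑ (allFin (suc s)) (λ w → ∑ (upTo (avail (+ h ℤ.+ d))) (λ p →
            ∑ (placements s (d ℤ.+ shift w) hs) (F ∘ (rook w (suc p) ∷_))))
  ∑-placements-∷ {s} d h hs F =
    trans (∑-++ (map (none ∷_) (placements s d hs)) (concatMap rooks (allFin (suc s))) F)
     (+-cong (∑-map (placements s d hs) (none ∷_) F)
       (trans (∑-concatMap (allFin (suc s)) rooks F)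
         (∑-cong (allFin (suc s)) λ w →
           trans (∑-concatMap (upTo (avail (+ h ℤ.+ d))) (rooksAt w) F)
             (∑-cong (upTo (avail (+ h ℤ.+ d))) λ p →
               ∑-map (placements s (d ℤ.+ shift w) hs) (rook w (suc p) ∷_) F))))
    where
    rooksAt : Fin (suc s) → ℕ → List (List (Choice s))
    rooksAt w p = map (rook w (suc p) ∷_) (placements s (d ℤ.+ shift w) hs)
    rooks : Fin (suc s) → List (List (Choice s))
    rooks w = concatMap (rooksAt w) (upTo (avail (+ h ℤ.+ d)))

  ∑-placements-++ : ∀ {s} d hs ks (F : List (Choice s) → Carrier) →
    ∑ (placements s d (hs ++ ks)) F
      ≈ ∑ (placements s d hs) (λ φ → ∑ (placements s (d ℤ.+ rowOffset φ) ks) (λ χ → F (φ ++ χ)))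
  ∑-placements-++ {s} d [] ks F =
    sym (trans (+-identityʳ _)
               (reflexive (≡.cong (λ d′ → ∑ (placements s d′ ks) F) (ℤₚ.+-identityʳ d))))
  ∑-placements-++ {s} d (h ∷ hs) ks F =
    trans (∑-placements-∷ d h (hs ++ ks) F)
     (trans (+-cong (∑-placements-++ d hs ks (F ∘ (none ∷_)))
                    (∑-cong (allFin (suc s)) λ w → ∑-cong (upTo (avail (+ h ℤ.+ d))) λ p →
                       trans (∑-placements-++ (d ℤ.+ shift w) hs ks (F ∘ (rook w (suc p) ∷_)))
                             (∑-cong (placements s (d ℤ.+ shift w) hs) λ φ → reflexive
                               (≡.cong (λ d′ → ∑ (placements s d′ ks) (λ χ → F (rook w (suc p) ∷ φ ++ χ)))
                                       (ℤₚ.+-assoc d (shift w) (rowOffset φ))))))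
            (sym (∑-placements-∷ d h hs _)))

  open import Algebra.Properties.CommutativeSemigroup *-commutativeSemigroup using (x∙yz≈z∙xy)
  open import Relation.Binary.Reasoning.Setoid setoid

  pow-+ : ∀ x m n → pow R x (m ℕ.+ n) ≈ pow R x m * pow R x n
  pow-+ x zero n = sym (*-identityˡ _)
  pow-+ x (suc m) n = trans (*-congˡ (pow-+ x m n)) (sym (*-assoc _ _ _))

  powℤ-avail : ∀ q {z} → ℤ.0ℤ ℤ.≤ z → powℤ R q z ≡ pow R q (avail z)
  powℤ-avail q (ℤ.+≤+ _) = ≡.refl

  qint≡∑ : ∀ q z → qint R q z ≡ ∑ (upTo (avail z)) (pow R q)
  qint≡∑ q (+ n) = ≡.refl
  qint≡∑ q ℤ.-[1+ n ] = ≡.refl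

  αpow-tabulate : ∀ {s} (α : Fin (suc s) → Carrier) k →
    αpow R α k ≡ foldr _*_ 1# (tabulate (λ j → pow R (α j) (lookup k j)))
  αpow-tabulate α k = ≡.cong (foldr _*_ 1#) (map-tabulate (λ j → j) (λ j → pow R (α j) (lookup k j)))

  αpow-updateAt-suc : ∀ {s} (α : Fin (suc s) → Carrier) k w →
    αpow R α (updateAt k w suc) ≈ α w * αpow R α k
  αpow-updateAt-suc α k w =
    trans (reflexive (αpow-tabulate α (updateAt k w suc)))
     (trans (foldr-tabulate-updateAt-suc *-commutativeMonoid (λ j → pow R (α j)) α (λ _ _ → refl) k w)
            (*-congˡ (reflexive (≡.sym (αpow-tabulate α k)))))

  αpow-replicate-0 : ∀ {s} (α : Fin (suc s) → Carrier) → αpow R α (replicate (suc s) 0) ≈ 1#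
  αpow-replicate-0 {s} α =
    trans (reflexive (αpow-tabulate α (replicate (suc s) 0)))
          (foldr-tabulate-replicate-0 *-commutativeMonoid (suc s) (λ j → pow R (α j)) (λ _ → refl))

  ifDec : ∀ {P : Set} → Dec P → Carrier → Carrier
  ifDec (yes _) x = x
  ifDec (no _) x = 0#

  ifType : ∀ {n} → Vec ℕ n → Vec ℕ n → Carrier → Carrier
  ifType t k = ifDec (≡-dec ℕ._≟_ t k)

  ifType-≡ : ∀ {n} {t k : Vec ℕ n} x → t ≡ k → ifType t k x ≡ x
  ifType-≡ {t = t} {k} x t≡k with ≡-dec ℕ._≟_ t k
  ... | yes _ = ≡.refl
  ... | no t≢k = ⊥-elim (t≢k t≡k)

  ifType-≢ : ∀ {n} {t k : Vec ℕ n} x → t ≢ k → ifType t k x ≡ 0#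
  ifType-≢ {t = t} {k} x t≢k with ≡-dec ℕ._≟_ t k
  ... | yes t≡k = ⊥-elim (t≢k t≡k)
  ... | no _ = ≡.refl

  ifType-cong : ∀ {n} {t k : Vec ℕ n} {x y} → x ≈ y → ifType t k x ≈ ifType t k y
  ifType-cong {t = t} {k} x≈y with ≡-dec ℕ._≟_ t k
  ... | yes _ = x≈y
  ... | no _ = refl

  ifType-*ˡ : ∀ {n} (t k : Vec ℕ n) a x → ifType t k (a * x) ≈ a * ifType t k x
  ifType-*ˡ t k a x with ≡-dec ℕ._≟_ t k
  ... | yes _ = refl
  ... | no _ = sym (zeroʳ a)

  ifSuc : ℕ → (ℕ → Carrier) → Carrier
  ifSuc zero f = 0#
  ifSuc (suc j) f = f j

  module _ {s : ℕ} (α : Fin (suc s) → Carrier) (q : Carrier) where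

    weight : Vec ℕ (suc s) → List ℕ → List (Choice s) → Carrier
    weight k B φ = ifType (typeOf φ) k (pow R q (emptyBoxes (+ 0) B φ))

    mutual
      mk≡ : ∀ k B → mk R s α q k B ≡ αpow R α k * ∑ (placements s (+ 0) B) (weight k B)
      mk≡ k B = ≡.cong (λ xs → αpow R α k * sumL R xs) (map-cong (summand≡weight k B) (placements s (+ 0) B))

      -- The left-hand side is the summand local to mk, which cannot be named; it is
      -- solved from the use above, which the mutual block checks first.
      summand≡weight : ∀ k B φ → _ ≡ weight k B φ
      summand≡weight k B φ with ≡-dec ℕ._≟_ (typeOf φ) k
      ... | yes _ = ≡.refl
      ... | no _ = ≡.refl

    mkOrZero≈∑ : ∀ k r B →
      ∑ (placements s (+ 0) B) (λ φ → ifSuc (lookup k r) (λ j → αpow R α (updateAt k r (λ _ → j)) * weight (updateAt k r (λ _ → j)) B φ))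
        ≈ mkOrZero R s α q k r B
    mkOrZero≈∑ k r B with lookup k r
    ... | zero = ∑-zero (placements s (+ 0) B) (λ _ → refl)
    ... | suc j = trans (∑-*ˡ (placements s (+ 0) B) _ _) (reflexive (≡.sym (mk≡ (updateAt k r (λ _ → j)) B)))

    ∑-weight-replicate-0 : ∀ B →
      ∑ (placements s (+ 0) B) (weight (replicate (suc s) 0) B) ≈ pow R q (foldr ℕ._+_ 0 B)
    ∑-weight-replicate-0 [] = trans (+-identityʳ _) (reflexive (ifType-≡ {t = replicate (suc s) 0} 1# ≡.refl))
    ∑-weight-replicate-0 (h ∷ B) =
      trans (∑-placements-∷ (+ 0) h B (weight 0s (h ∷ B)))
       (trans (+-cong (∑-cong (placements s (+ 0) B) none-column)
                      (∑-zero (allFin (suc s)) λ w → ∑-zero (upTo (h ℕ.+ 0)) λ p →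
                        ∑-zero (placements s (+ 0 ℤ.+ shift w) B) λ φ →
                          reflexive (ifType-≢ _ (updateAt-suc≢ (typeOf φ) 0s w (lookup-replicate w 0)))))
        (trans (+-identityʳ _)
         (trans (∑-*ˡ (placements s (+ 0) B) (pow R q h) (weight 0s B))
          (trans (*-congˡ (∑-weight-replicate-0 B)) (sym (pow-+ q h _))))))
      where
      0s : Vec ℕ (suc s)
      0s = replicate (suc s) 0
      none-column : ∀ φ → weight 0s (h ∷ B) (none ∷ φ) ≈ pow R q h * weight 0s B φ
      none-column φ =
        trans (reflexive (≡.cong (λ n → ifType (typeOf φ) 0s (pow R q (n ℕ.+ emptyBoxes (+ 0) B φ))) (ℕₚ.+-identityʳ h)))
         (trans (ifType-cong {t = typeOf φ} {0s} (pow-+ q h _)) (ifType-*ˡ (typeOf φ) 0s _ _))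

    mk-replicate-0 : ∀ B → mk R s α q (replicate (suc s) 0) B ≈ pow R q (foldr ℕ._+_ 0 B)
    mk-replicate-0 B =
      trans (reflexive (mk≡ (replicate (suc s) 0) B))
       (trans (*-cong (αpow-replicate-0 α) (∑-weight-replicate-0 B)) (*-identityˡ _))

    module _ (k : Vec ℕ (suc s)) (h : ℕ) where

      last-column-empty : ∀ t e D → D ≡ offsetOf t → ℤ.0ℤ ℤ.≤ + h ℤ.+ D →
        αpow R α k * ifType t k (pow R q (e ℕ.+ avail (+ h ℤ.+ D)))
          ≈ powℤ R q (+ h ℤ.+ offsetOf k) * (αpow R α k * ifType t k (pow R q e))
      last-column-empty t e D ≡.refl 0≤h+D with ≡-dec ℕ._≟_ t k
      ... | yes ≡.refl = begin
        αpow R α k * pow R q (e ℕ.+ avail z)          ≈⟨ *-congˡ (pow-+ q e (avail z)) ⟩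
        αpow R α k * (pow R q e * pow R q (avail z))  ≈⟨ x∙yz≈z∙xy _ _ _ ⟩
        pow R q (avail z) * (αpow R α k * pow R q e)  ≡⟨ ≡.cong (_* _) (≡.sym (powℤ-avail q 0≤h+D)) ⟩
        powℤ R q z * (αpow R α k * pow R q e)         ∎
        where z = + h ℤ.+ offsetOf k
      ... | no _ = trans (zeroʳ _) (sym (trans (*-congˡ (zeroʳ _)) (zeroʳ _)))

      last-column-rook : ∀ r t e D → D ≡ offsetOf t →
        αpow R α k * ∑ (upTo (avail (+ h ℤ.+ D))) (λ p → ifType (updateAt t r suc) k (pow R q (e ℕ.+ p)))
          ≈ α r * (qint R q (+ h ℤ.+ offsetOf k ℤ.- shift r)
                   * ifSuc (lookup k r) (λ j → αpow R α (updateAt k r (λ _ → j))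
                                               * ifType t (updateAt k r (λ _ → j)) (pow R q e)))
      last-column-rook r t e D ≡.refl with lookup k r in k[r]
      ... | zero =
        trans (*-congˡ (∑-zero (upTo (avail (+ h ℤ.+ offsetOf t))) λ _ → reflexive (ifType-≢ _ (updateAt-suc≢ t k r k[r]))))
              (trans (zeroʳ _) (sym (trans (*-congˡ (zeroʳ _)) (zeroʳ _))))
      ... | suc j with ≡-dec ℕ._≟_ t (updateAt k r (λ _ → j))
      ...   | no t≢k′ =
        trans (*-congˡ (∑-zero (upTo (avail (+ h ℤ.+ offsetOf t))) λ _ → reflexive (ifType-≢ _ (t≢k′ ∘ updateAt-suc≡⇒ t k r k[r]))))
              (trans (zeroʳ _) (sym (trans (*-congˡ (trans (*-congˡ (zeroʳ _)) (zeroʳ _))) (zeroʳ _))))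
      ...   | yes ≡.refl = begin
        αpow R α k * ∑ (upTo (avail z′)) (λ p → ifType (updateAt k′ r suc) k (pow R q (e ℕ.+ p)))
          ≈⟨ *-congˡ (∑-cong (upTo (avail z′)) λ p → trans (reflexive (ifType-≡ _ k′↑≡k)) (pow-+ q e p)) ⟩
        αpow R α k * ∑ (upTo (avail z′)) (λ p → pow R q e * pow R q p)
          ≈⟨ *-congˡ (∑-*ˡ (upTo (avail z′)) (pow R q e) (pow R q)) ⟩
        αpow R α k * (pow R q e * ∑ (upTo (avail z′)) (pow R q))
          ≈⟨ *-cong αpow-k (*-congˡ (reflexive (≡.sym (qint≡∑ q z′)))) ⟩
        (α r * αpow R α k′) * (pow R q e * qint R q z′)
          ≈⟨ trans (*-assoc _ _ _) (*-congˡ (x∙yz≈z∙xy _ _ _)) ⟩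
        α r * (qint R q z′ * (αpow R α k′ * pow R q e))
          ≡⟨ ≡.cong (λ z → α r * (qint R q z * (αpow R α k′ * pow R q e))) (≡.sym z≡z′) ⟩
        α r * (qint R q (+ h ℤ.+ offsetOf k ℤ.- shift r) * (αpow R α k′ * pow R q e))
          ∎
        where
        k′ : Vec ℕ (suc s)
        k′ = updateAt k r (λ _ → j)
        z′ : ℤ
        z′ = + h ℤ.+ offsetOf k′
        k′↑≡k : updateAt k′ r suc ≡ k
        k′↑≡k = updateAt-suc≡⇐ k′ k r k[r] ≡.refl
        αpow-k : αpow R α k ≈ α r * αpow R α k′
        αpow-k = trans (reflexive (≡.cong (αpow R α) (≡.sym k′↑≡k))) (αpow-updateAt-suc α k′ r)
        z≡z′ : + h ℤ.+ offsetOf k ℤ.- shift r ≡ z′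
        z≡z′ = ≡.trans (≡.cong (λ o → + h ℤ.+ o ℤ.- shift r)
                               (≡.trans (≡.cong offsetOf (≡.sym k′↑≡k)) (offsetOf-updateAt-suc k′ r)))
                       (a+[b+c]-b≡a+c (+ h) (shift r) (offsetOf k′))

      ∑-weight-++-column : ∀ hs φ → length φ ≡ length hs →
        let e = emptyBoxes (+ 0) hs φ
            D = + 0 ℤ.+ rowOffset φ in
        ∑ (placements s D [ h ]) (λ χ → weight k (hs ++ [ h ]) (φ ++ χ))
          ≈ ifType (typeOf φ) k (pow R q (e ℕ.+ avail (+ h ℤ.+ D)))
            + ∑ (allFin (suc s)) (λ w → ∑ (upTo (avail (+ h ℤ.+ D))) (λ p →
                ifType (updateAt (typeOf φ) w suc) k (pow R q (e ℕ.+ p))))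
      ∑-weight-++-column hs φ |φ|≡|hs| =
        trans (∑-placements-∷ D h [] (λ χ → weight k (hs ++ [ h ]) (φ ++ χ)))
          (+-cong (trans (+-identityʳ _) (reflexive (weight-++ (typeOf-++-none φ) (ℕₚ.+-identityʳ _))))
                  (∑-cong (allFin (suc s)) λ w → ∑-cong (upTo (avail (+ h ℤ.+ D))) λ p →
                     trans (+-identityʳ _) (reflexive (weight-++ (typeOf-++-rook φ w (suc p)) (ℕₚ.+-identityʳ p)))))
        where
        D : ℤ
        D = + 0 ℤ.+ rowOffset φ
        weight-++ : ∀ {c t n} → typeOf (φ ++ [ c ]) ≡ t → emptyBoxes D [ h ] [ c ] ≡ n →
          weight k (hs ++ [ h ]) (φ ++ [ c ]) ≡ ifType t k (pow R q (emptyBoxes (+ 0) hs φ ℕ.+ n))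
        weight-++ {c} type≡ boxes≡ =
          ≡.cong₂ (λ t n → ifType t k (pow R q n)) type≡
            (≡.trans (emptyBoxes-++ (+ 0) hs [ h ] φ [ c ] |φ|≡|hs|)
                     (≡.cong (emptyBoxes (+ 0) hs φ ℕ.+_) boxes≡))

      last-column : ∀ hs φ → length φ ≡ length hs → ℤ.0ℤ ℤ.≤ + h ℤ.+ (+ 0 ℤ.+ rowOffset φ) →
        αpow R α k * ∑ (placements s (+ 0 ℤ.+ rowOffset φ) [ h ]) (λ χ → weight k (hs ++ [ h ]) (φ ++ χ))
          ≈ powℤ R q (+ h ℤ.+ offsetOf k) * (αpow R α k * weight k hs φ)
            + ∑ (allFin (suc s)) (λ r → α r * (qint R q (+ h ℤ.+ offsetOf k ℤ.- shift r)
                * ifSuc (lookup k r) (λ j → αpow R α (updateAt k r (λ _ → j)) * weight (updateAt k r (λ _ → j)) hs φ)))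
      last-column hs φ |φ|≡|hs| 0≤h+D =
        trans (*-congˡ (∑-weight-++-column hs φ |φ|≡|hs|))
         (trans (distribˡ _ _ _)
          (+-cong (last-column-empty (typeOf φ) e D D≡ 0≤h+D)
                  (trans (sym (∑-*ˡ (allFin (suc s)) _ _))
                         (∑-cong (allFin (suc s)) λ r → last-column-rook r (typeOf φ) e D D≡))))
        where
        e : ℕ
        e = emptyBoxes (+ 0) hs φ
        D : ℤ
        D = + 0 ℤ.+ rowOffset φ
        D≡ : D ≡ offsetOf (typeOf φ)
        D≡ = ≡.trans (ℤₚ.+-identityˡ (rowOffset φ)) (rowOffset≡offsetOf-typeOf φ)

      mk-++-column : ∀ hs → Linked _≤_ (0 ∷ hs ++ [ h ]) →
        mk R s α q k (hs ++ [ h ])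
          ≈ powℤ R q (+ h ℤ.+ offsetOf k) * mk R s α q k hs
            + ∑ (allFin (suc s)) (λ r → α r * (qint R q (+ h ℤ.+ offsetOf k ℤ.- shift r) * mkOrZero R s α q k r hs))
      mk-++-column hs sorted = begin
        mk R s α q k (hs ++ [ h ])
          ≡⟨ mk≡ k (hs ++ [ h ]) ⟩
        αpow R α k * ∑ (placements s (+ 0) (hs ++ [ h ])) (weight k (hs ++ [ h ]))
          ≈⟨ *-congˡ (∑-placements-++ (+ 0) hs [ h ] (weight k (hs ++ [ h ]))) ⟩
        αpow R α k * ∑ Φ (λ φ → ∑ (placements s (+ 0 ℤ.+ rowOffset φ) [ h ]) (λ χ → weight k (hs ++ [ h ]) (φ ++ χ)))
          ≈⟨ sym (∑-*ˡ Φ _ _) ⟩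
        ∑ Φ (λ φ → αpow R α k * ∑ (placements s (+ 0 ℤ.+ rowOffset φ) [ h ]) (λ χ → weight k (hs ++ [ h ]) (φ ++ χ)))
          ≈⟨ ∑-cong-All (All.zipWith (λ {φ} (|φ|≡|hs| , 0≤h+D) → last-column hs φ |φ|≡|hs| 0≤h+D)
                                     (placements-length s (+ 0) hs , placements-avail-nonneg s (+ 0) hs h (ℤ.+≤+ z≤n) sorted)) ⟩
        ∑ Φ (λ φ → P * (αpow R α k * weight k hs φ) + ∑ Fs (λ r → α r * (Q r * rest r φ)))
          ≈⟨ ∑-+ Φ _ _ ⟩
        ∑ Φ (λ φ → P * (αpow R α k * weight k hs φ)) + ∑ Φ (λ φ → ∑ Fs (λ r → α r * (Q r * rest r φ)))
          ≈⟨ +-cong (trans (∑-*ˡ Φ P _) (*-congˡ (∑-*ˡ Φ _ _))) (∑-swap Φ Fs _) ⟩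
        P * (αpow R α k * ∑ Φ (weight k hs)) + ∑ Fs (λ r → ∑ Φ (λ φ → α r * (Q r * rest r φ)))
          ≈⟨ +-cong (*-congˡ (reflexive (≡.sym (mk≡ k hs))))
                    (∑-cong Fs λ r → trans (∑-*ˡ Φ (α r) _) (*-congˡ (trans (∑-*ˡ Φ (Q r) _) (*-congˡ (mkOrZero≈∑ k r hs))))) ⟩
        P * mk R s α q k hs + ∑ Fs (λ r → α r * (Q r * mkOrZero R s α q k r hs))
          ∎
        where
        Φ : List (List (Choice s))
        Φ = placements s (+ 0) hs
        Fs : List (Fin (suc s))
        Fs = allFin (suc s)
        P : Carrier
        P = powℤ R q (+ h ℤ.+ offsetOf k)
        Q : Fin (suc s) → Carrier
        Q r = qint R q (+ h ℤ.+ offsetOf k ℤ.- shift r)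
        rest : Fin (suc s) → List (Choice s) → Carrier
        rest r φ = ifSuc (lookup k r) (λ j → αpow R α (updateAt k r (λ _ → j)) * weight (updateAt k r (λ _ → j)) hs φ)

theorem4p19 : {c ℓ : Level} (R : CommutativeRing c ℓ) →
    let open CommutativeRing R in
    (q : Carrier) (s : ℕ) (α : Fin (suc s) → Carrier) (m : ℕ)
    (lam : Fin (suc m) → ℕ) → (∀ i j → i Fin.≤ j → lam i ≤ lam j) →
    (k : Vec ℕ (suc s)) →
    (mk R s α q k (board (suc m) lam)
      ≈ (powℤ R q ((+ lam (fromℕ m)) ℤ.+ offsetOf k)
           * mk R s α q k (board m (λ i → lam (inject₁ i)))
         + foldr _+_ 0#
             (map (λ r → α r
                     * (qint R q ((+ lam (fromℕ m)) ℤ.+ offsetOf k ℤ.- shift r)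
                     * mkOrZero R s α q k r (board m (λ i → lam (inject₁ i)))))
                  (allFin (suc s)))))
    × (mk R s α q (replicate (suc s) 0) (board (suc m) lam) ≈ pow R q (size (suc m) lam))
theorem4p19 R q s α m lam mono k =
  trans (reflexive (≡.cong (mk R s α q k) (board-++-last m lam)))
        (mk-++-column R α q k (lam (fromℕ m)) (board m (lam ∘ inject₁)) sorted)
  , mk-replicate-0 R α q (board (suc m) lam)
  where
  open CommutativeRing R using (trans; reflexive)
  sorted : Linked _≤_ (0 ∷ board m (lam ∘ inject₁) ++ [ lam (fromℕ m) ])
  sorted = ≡.subst (λ B → Linked _≤_ (0 ∷ B)) (board-++-last m lam) (board-sorted lam mono)
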